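{- Assume $q\equiv1\pmod4$ and let $P\in\mathcal{O}$. Then there exists a set $\mathcal{M}(P)$ of internal points, of odd cardinality, such that for every external point $Q$ on the line $P^\perp$, the number of points $R\in\mathcal{M}(P)$ for which the line $QR$ is passant is odd.
   Context: $\mathrm{PG}(2,q)$ has points $(a_0,a_1,a_2)$ and lines $[b_0,b_1,b_2]$ with incidence $a_0b_0+a_1b_1+a_2b_2=0$; $\mathcal{O}=\{(1,t,t^2):t\in\mathbb{F}_q\}\cup\{(0,0,1)\}$. Lines are passant/tangent/secant if they meet $\mathcal{O}$ in $0/1/2$ points; points off $\mathcal{O}$ are external/internal if $a_1^2-a_0a_2$ is a nonzero square/non-square in $\mathbb{F}_q$. The polarity $\perp$ maps $(x,y,z)$ to $[z,-2y,x]$ (so $P^\perp$ is the tangent line at $P$ for $P\in\mathcal{O}$). -}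

module Defs where

open import Level using (0ℓ)
open import Data.Nat as ℕ using (ℕ)
open import Data.Nat.Divisibility as ND using ()
open import Data.Product using (Σ; proj₁; ∃; ∃-syntax; _×_; _,_)
open import Data.Sum using (_⊎_)
open import Data.List using (List; length; _++_)
open import Data.List.Membership.Propositional using (_∈_)
open import Data.List.Relation.Unary.All using (All)
open import Data.List.Relation.Unary.AllPairs using (AllPairs)
open import Data.List.Relation.Unary.Unique.Propositional using (Unique)
open import Data.List.Relation.Binary.Permutation.Propositional using (_↭_)
open import Relation.Nullary using (¬_)
open import Relation.Binary.PropositionalEquality using (_≡_; _≢_)
import Algebra.Structures as AS

record FiniteField : Set₁ where
  infixl 7 _*_
  infixl 6 _+_
  field
    F     : Set
    _+_   : F → F → F
    _*_   : F → F → F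
    -_    : F → F
    0F    : F
    1F    : F
    isCommutativeRing : AS.IsCommutativeRing (_≡_ {A = F}) _+_ _*_ -_ 0F 1F
    0≢1   : 0F ≢ 1F
    inverse : ∀ x → x ≢ 0F → ∃[ y ] (x * y ≡ 1F)
    elements  : List F
    complete  : ∀ x → x ∈ elements
    distinct  : Unique elements

  order : ℕ
  order = length elements

module PG2 (K : FiniteField) where
  open FiniteField K

  2F : F
  2F = 1F + 1F

  Triple : Set
  Triple = F × F × F

  NonZero : Triple → Set
  NonZero (a , b , c) = ¬ (a ≡ 0F × b ≡ 0F × c ≡ 0F)

  -- Points (a₀,a₁,a₂) and lines [b₀,b₁,b₂] of PG(2,q): nonzero triples,
  -- considered up to nonzero scalar multiples (relation _∼_).
  Point : Set
  Point = Σ Triple NonZero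

  Line : Set
  Line = Σ Triple NonZero

  scale : F → Triple → Triple
  scale λ' (a , b , c) = (λ' * a , λ' * b , λ' * c)

  _∼_ : Σ Triple NonZero → Σ Triple NonZero → Set
  (u , _) ∼ (v , _) = ∃[ λ' ] (λ' ≢ 0F × v ≡ scale λ' u)

  Incident : Point → Line → Set
  Incident ((a₀ , a₁ , a₂) , _) ((b₀ , b₁ , b₂) , _) =
    a₀ * b₀ + a₁ * b₁ + a₂ * b₂ ≡ 0F

  OnO : Point → Set
  OnO (u , _) = (∃[ t ] (∃[ λ' ] (λ' ≢ 0F × u ≡ scale λ' (1F , t , t * t))))
              ⊎ (∃[ λ' ] (λ' ≢ 0F × u ≡ scale λ' (0F , 0F , 1F)))

  Passant : Line → Set
  Passant L = ∀ (X : Point) → OnO X → ¬ Incident X L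

  IsSquare : F → Set
  IsSquare d = ∃[ x ] (x * x ≡ d)

  disc : Point → F
  disc ((a₀ , a₁ , a₂) , _) = a₁ * a₁ + - (a₀ * a₂)

  External : Point → Set
  External P = ¬ OnO P × disc P ≢ 0F × IsSquare (disc P)

  Internal : Point → Set
  Internal P = ¬ OnO P × ¬ IsSquare (disc P)

  perpTriple : Triple → Triple
  perpTriple (x , y , z) = (z , - (2F * y) , x)

  -- the line PQ: the unique line incident with both P and Q (P ≁ Q);
  -- "PQ is passant" means: every line through P and Q is passant.
  JoinPassant : Point → Point → Set
  JoinPassant P Q = ∀ (L : Line) → Incident P L → Incident Q L → Passant L

  IsPointSet : List Point → Set
  IsPointSet M = AllPairs (λ X Y → ¬ (X ∼ Y)) M

  Odd : ℕ → Set
  Odd n = ¬ (2 ND.∣ n)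

  -- the number of elements of M satisfying P is odd:
  -- M splits (up to reordering) into those satisfying P and those not.
  OddCount : (Point → Set) → List Point → Set
  OddCount Pr M = ∃[ xs ] ∃[ ys ] (M ↭ xs ++ ys × All Pr xs × All (λ X → ¬ Pr X) ys
                                   × Odd (length xs))

  -- Q lies on the line P^⊥ = [z,−2y,x] where P = (x,y,z)
  OnPerp : Point → Point → Set
  OnPerp ((x , y , z) , _) ((a₀ , a₁ , a₂) , _) =
    a₀ * z + a₁ * (- (2F * y)) + a₂ * x ≡ 0F

module Submission where

open import Defs
open import Data.Nat using (_%_)
open import Data.Product using (∃-syntax; _×_)
open import Data.List using (length)
open import Data.List.Relation.Unary.All using (All)
open import Relation.Binary.PropositionalEquality using (_≡_)
open import Algebra.Bundles using (CommutativeRing)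
open import Data.Product using (_,_)
open import Data.Sum using (inj₁; inj₂)
open import Relation.Binary.PropositionalEquality using (refl)

-- Fix δ such that δ and −δ are non-squares; this is where q ≡ 1 (mod 4) enters, through −1 being
-- a square. For P on 𝒪 parametrise 𝒪 ∖ {P} by φ, normalised so that the polar form of φ(a) and P
-- is 1, and take M(P) = {φ(a) − δP : a ∈ 𝔽}: q internal points, all with discriminant δ.
-- The discriminant of the line XY is polar(X,Y)² − 4 disc(X) disc(Y). For an external Q on P^⊥
-- and R = φ(a) − δP this is b² − 4δu² with b = x − 2ua affine in a and u² = disc(Q) ≠ 0, and QR
-- is passant exactly when it is a non-square. Substituting b for a and pairing b with −b leaves
-- only b = 0, where −4δu² is a non-square; hence the number of such R is odd.

module IntegerCoefficientSolver {c ℓ} (R : CommutativeRing c ℓ) where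
  open import Data.Nat as ℕ using (ℕ; zero; suc)
  import Data.Nat.Properties as ℕ
  open import Data.Integer as ℤ using (ℤ; +_; -[1+_]; _⊖_; _◃_; sign; ∣_∣)
  import Data.Integer.Properties as ℤ
  open import Data.Sign as Sign using (Sign)
  import Data.Maybe as Maybe
  open import Relation.Nullary.Decidable using (dec⇒maybe)
  open import Relation.Binary.PropositionalEquality using (cong)
  import Relation.Binary.Reasoning.Setoid as SetoidReasoning
  import Algebra.Properties.Ring as RingProperties
  import Algebra.Properties.CommutativeSemigroup as CommutativeSemigroupProperties
  import Algebra.Properties.Semiring.Mult.TCOptimised as Multiples
  open import Algebra.Solver.Ring.AlmostCommutativeRing using (fromCommutativeRing; _-Raw-AlmostCommutative⟶_)

  open CommutativeRing R renaming (refl to ≈-refl)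
  open RingProperties ring using (-0#≈0#; -‿involutive; -‿+-comm; -1*x≈-x)
  open CommutativeSemigroupProperties +-commutativeSemigroup using (interchange)
  open CommutativeSemigroupProperties *-commutativeSemigroup using () renaming (interchange to *-interchange)
  open Multiples semiring using (1+×; ×-homo-+; ×1-homo-*) renaming (_×_ to _×′_)
  open SetoidReasoning setoid

  private
    fromℤ : ℤ → Carrier
    fromℤ (+ n) = n ×′ 1#
    fromℤ -[1+ n ] = - (suc n ×′ 1#)

    [x+a]-[x+b]≈a-b : ∀ x a b → (x + a) - (x + b) ≈ a - b
    [x+a]-[x+b]≈a-b x a b = begin
      (x + a) - (x + b)       ≈⟨ +-congˡ (sym (-‿+-comm x b)) ⟩
      (x + a) + (- x + - b)   ≈⟨ interchange x a (- x) (- b) ⟩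
      (x - x) + (a - b)       ≈⟨ +-congʳ (-‿inverseʳ x) ⟩
      0# + (a - b)            ≈⟨ +-identityˡ (a - b) ⟩
      a - b                   ∎

    ⊖-homo : ∀ m n → fromℤ (m ⊖ n) ≈ m ×′ 1# - n ×′ 1#
    ⊖-homo zero zero = sym (trans (+-identityˡ (- 0#)) -0#≈0#)
    ⊖-homo zero (suc n) = sym (+-identityˡ _)
    ⊖-homo (suc m) zero = sym (trans (+-congˡ -0#≈0#) (+-identityʳ _))
    ⊖-homo (suc m) (suc n) = begin
      fromℤ (suc m ⊖ suc n)              ≡⟨ cong fromℤ (ℤ.[1+m]⊖[1+n]≡m⊖n m n) ⟩
      fromℤ (m ⊖ n)                      ≈⟨ ⊖-homo m n ⟩
      m ×′ 1# - n ×′ 1#                  ≈⟨ [x+a]-[x+b]≈a-b 1# _ _ ⟨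
      (1# + m ×′ 1#) - (1# + n ×′ 1#)    ≈⟨ +-cong (1+× m 1#) (-‿cong (1+× n 1#)) ⟨
      suc m ×′ 1# - suc n ×′ 1#          ∎

    +-homo : ∀ i j → fromℤ (i ℤ.+ j) ≈ fromℤ i + fromℤ j
    +-homo -[1+ m ] -[1+ n ] = begin
      - (suc (suc (m ℕ.+ n)) ×′ 1#)        ≡⟨ cong (λ k → - (suc k ×′ 1#)) (ℕ.+-suc m n) ⟨
      - ((suc m ℕ.+ suc n) ×′ 1#)          ≈⟨ -‿cong (×-homo-+ 1# (suc m) (suc n)) ⟩
      - (suc m ×′ 1# + suc n ×′ 1#)        ≈⟨ -‿+-comm _ _ ⟨
      - (suc m ×′ 1#) + - (suc n ×′ 1#)    ∎
    +-homo -[1+ m ] (+ n) = trans (⊖-homo n (suc m)) (+-comm _ _)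
    +-homo (+ m) -[1+ n ] = ⊖-homo m (suc n)
    +-homo (+ m) (+ n) = ×-homo-+ 1# m n

    fromSign : Sign → Carrier
    fromSign Sign.+ = 1#
    fromSign Sign.- = - 1#

    fromSign-homo : ∀ s t → fromSign (s Sign.* t) ≈ fromSign s * fromSign t
    fromSign-homo Sign.+ t = sym (*-identityˡ _)
    fromSign-homo Sign.- Sign.+ = sym (*-identityʳ _)
    fromSign-homo Sign.- Sign.- = sym (trans (-1*x≈-x _) (-‿involutive _))

    ◃-homo : ∀ s n → fromℤ (s ◃ n) ≈ fromSign s * (n ×′ 1#)
    ◃-homo Sign.- zero = sym (zeroʳ _)
    ◃-homo Sign.+ zero = sym (zeroʳ _)
    ◃-homo Sign.- (suc n) = sym (-1*x≈-x _)
    ◃-homo Sign.+ (suc n) = sym (*-identityˡ _)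

    sign-abs : ∀ i → fromℤ i ≈ fromSign (sign i) * (∣ i ∣ ×′ 1#)
    sign-abs i = begin
      fromℤ i                            ≡⟨ cong fromℤ (ℤ.◃-inverse i) ⟨
      fromℤ (sign i ◃ ∣ i ∣)             ≈⟨ ◃-homo (sign i) ∣ i ∣ ⟩
      fromSign (sign i) * (∣ i ∣ ×′ 1#)  ∎

    *-homo : ∀ i j → fromℤ (i ℤ.* j) ≈ fromℤ i * fromℤ j
    *-homo i j = begin
      fromℤ ((sign i Sign.* sign j) ◃ (∣ i ∣ ℕ.* ∣ j ∣))
        ≈⟨ ◃-homo (sign i Sign.* sign j) (∣ i ∣ ℕ.* ∣ j ∣) ⟩
      fromSign (sign i Sign.* sign j) * ((∣ i ∣ ℕ.* ∣ j ∣) ×′ 1#)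
        ≈⟨ *-cong (fromSign-homo (sign i) (sign j)) (×1-homo-* ∣ i ∣ ∣ j ∣) ⟩
      (fromSign (sign i) * fromSign (sign j)) * ((∣ i ∣ ×′ 1#) * (∣ j ∣ ×′ 1#))
        ≈⟨ *-interchange _ _ _ _ ⟩
      (fromSign (sign i) * (∣ i ∣ ×′ 1#)) * (fromSign (sign j) * (∣ j ∣ ×′ 1#))
        ≈⟨ *-cong (sign-abs i) (sign-abs j) ⟨
      fromℤ i * fromℤ j
        ∎

    -‿homo : ∀ i → fromℤ (ℤ.- i) ≈ - fromℤ i
    -‿homo (+ zero) = sym -0#≈0#
    -‿homo (+ suc n) = ≈-refl
    -‿homo -[1+ n ] = sym (-‿involutive _)

    homomorphism : ℤ.+-*-rawRing -Raw-AlmostCommutative⟶ fromCommutativeRing R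
    homomorphism = record
      { ⟦_⟧ = fromℤ ; +-homo = +-homo ; *-homo = *-homo ; -‿homo = -‿homo
      ; 0-homo = ≈-refl ; 1-homo = ≈-refl }

  open import Algebra.Solver.Ring ℤ.+-*-rawRing (fromCommutativeRing R) homomorphism
    (λ i j → Maybe.map (λ i≡j → reflexive (cong fromℤ i≡j)) (dec⇒maybe (i ℤ.≟ j))) public

  κ : ∀ {n} → ℕ → Polynomial n
  κ k = con (+ k)

module Counting where
  open import Level using (Level)
  open import Data.Nat using (ℕ; suc; _+_; _*_; _<_)
  open import Data.Nat.Properties using (+-suc; +-identityʳ)
  open import Data.Fin as Fin using (Fin)
  import Data.Fin.Properties as Fin
  open import Data.Product using (∃; _×_; _,_; proj₂)
  open import Data.List using (List; []; _∷_; length; filter; map; lookup; _++_)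
  open import Data.List.Properties using (filter-≐; filter-none; filter-all; filter-some; length-map)
  open import Data.List.Membership.Propositional using (_∈_; lose)
  open import Data.List.Membership.Propositional.Properties using (∈-filter⁺; ∈-filter⁻; ∈-map⁺; ∈-map⁻)
  open import Data.List.Membership.Propositional.Properties.WithK using (unique∧set⇒bag)
  import Data.List.Relation.Unary.All as All
  import Data.List.Relation.Unary.AllPairs as AllPairs
  open import Data.List.Relation.Unary.Any as Any using (here; any?)
  open import Data.List.Relation.Unary.Any.Properties using (lookup-index)
  open import Data.List.Relation.Unary.Unique.Propositional using (Unique)
  import Data.List.Relation.Unary.Unique.Propositional.Properties as Unique
  open import Data.List.Relation.Binary.Permutation.Propositional using (_↭_; ↭-refl; ↭-sym; ↭-trans; ↭-prep)
  open import Data.List.Relation.Binary.Permutation.Propositional.Properties using (↭-length; shift)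
  open import Data.List.Relation.Binary.BagAndSetEquality using (∼bag⇒↭)
  open import Function using (_∘_)
  open import Function.Bundles using (mk⇔)
  open import Relation.Nullary using (¬_; Dec; yes; no; contradiction)
  open import Relation.Nullary.Decidable using (map′)
  open import Relation.Unary using (Pred; Decidable; _≐_)
  open import Relation.Unary.Properties using (∁?; _∩?_)
  open import Relation.Binary.Definitions using (tri<; tri≈; tri>)
  open import Relation.Binary.PropositionalEquality

  private
    variable
      ℓ ℓ′ : Level
      A : Set

  ↭-filter-partition : {P : Pred A ℓ} (P? : Decidable P) (xs : List A) →
    xs ↭ filter P? xs ++ filter (∁? P?) xs
  ↭-filter-partition P? [] = ↭-refl
  ↭-filter-partition P? (x ∷ xs) with P? x
  ... | yes _ = ↭-prep x (↭-filter-partition P? xs)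
  ... | no _ = ↭-trans (↭-prep x (↭-filter-partition P? xs)) (↭-sym (shift x (filter P? xs) _))

  length-filter-∩∁ : {P : Pred A ℓ} {Q : Pred A ℓ′} (P? : Decidable P) (Q? : Decidable Q) (xs : List A) →
    length (filter P? xs) ≡ length (filter (P? ∩? Q?) xs) + length (filter (P? ∩? ∁? Q?) xs)
  length-filter-∩∁ P? Q? [] = refl
  length-filter-∩∁ P? Q? (x ∷ xs) with P? x | Q? x
  ... | yes _ | yes _ = cong suc (length-filter-∩∁ P? Q? xs)
  ... | yes _ | no _ = trans (cong suc (length-filter-∩∁ P? Q? xs)) (sym (+-suc _ _))
  ... | no _ | _ = length-filter-∩∁ P? Q? xs

  ↭-of-same-elements : {xs ys : List A} → Unique xs → Unique ys →
    (∀ {x} → x ∈ xs → x ∈ ys) → (∀ {x} → x ∈ ys → x ∈ xs) → xs ↭ ys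
  ↭-of-same-elements xs! ys! to from = ∼bag⇒↭ (unique∧set⇒bag xs! ys! (mk⇔ to from))

  module Enumeration {A : Set} (elements : List A)
                     (complete : ∀ x → x ∈ elements) (distinct : Unique elements) where

    index : A → Fin (length elements)
    index x = Any.index (complete x)

    index-injective : ∀ {x y} → index x ≡ index y → x ≡ y
    index-injective {x} {y} eq =
      trans (lookup-index (complete x)) (trans (cong (lookup elements) eq) (sym (lookup-index (complete y))))

    infix 4 _≟_ _≺_ _≺?_

    _≟_ : (x y : A) → Dec (x ≡ y)
    x ≟ y = map′ index-injective (cong index) (index x Fin.≟ index y)

    _≺_ : A → A → Set
    x ≺ y = index x Fin.< index y

    _≺?_ : (x y : A) → Dec (x ≺ y)
    x ≺? y = index x Fin.<? index y

    ≺-irrefl : ∀ x → ¬ x ≺ x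
    ≺-irrefl x = Fin.<-irrefl refl

    ≺-asym : ∀ {x y} → x ≺ y → ¬ y ≺ x
    ≺-asym = Fin.<-asym

    ≺-connex : ∀ {x y} → x ≢ y → ¬ x ≺ y → y ≺ x
    ≺-connex {x} {y} x≢y x⊀y with Fin.<-cmp (index x) (index y)
    ... | tri< x≺y _ _ = contradiction x≺y x⊀y
    ... | tri≈ _ eq _ = contradiction (index-injective eq) x≢y
    ... | tri> _ _ y≺x = y≺x

    search : {P : Pred A ℓ} → Decidable P → Dec (∃ P)
    search P? = map′ Any.satisfied (λ (x , px) → lose (complete x) px) (any? P? elements)

    count : {P : Pred A ℓ} → Decidable P → ℕ
    count P? = length (filter P? elements)

    count-∩∁ : {P : Pred A ℓ} {Q : Pred A ℓ′} (P? : Decidable P) (Q? : Decidable Q) →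
      count P? ≡ count (P? ∩? Q?) + count (P? ∩? ∁? Q?)
    count-∩∁ P? Q? = length-filter-∩∁ P? Q? elements

    count-≐ : {P : Pred A ℓ} {Q : Pred A ℓ′} (P? : Decidable P) (Q? : Decidable Q) →
      P ≐ Q → count P? ≡ count Q?
    count-≐ P? Q? P≐Q = cong length (filter-≐ P? Q? P≐Q elements)

    count-none : {P : Pred A ℓ} (P? : Decidable P) → (∀ x → ¬ P x) → count P? ≡ 0
    count-none P? ¬P = cong length (filter-none P? {xs = elements} (All.tabulate λ {x} _ → ¬P x))

    count-all : {P : Pred A ℓ} (P? : Decidable P) → (∀ x → P x) → count P? ≡ length elements
    count-all P? allP = cong length (filter-all P? {xs = elements} (All.tabulate λ {x} _ → allP x))

    count-pos : {P : Pred A ℓ} (P? : Decidable P) → ∀ {x} → P x → 0 < count P?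
    count-pos P? {x} px = filter-some P? (lose (complete x) px)

    count-≡ : ∀ a → count (_≟ a) ≡ 1
    count-≡ a = ↭-length (↭-of-same-elements (Unique.filter⁺ (_≟ a) distinct) (All.[] AllPairs.∷ AllPairs.[]) to from)
      where
      to : ∀ {x} → x ∈ filter (_≟ a) elements → x ∈ a ∷ []
      to x∈ = here (proj₂ (∈-filter⁻ (_≟ a) {xs = elements} x∈))
      from : ∀ {x} → x ∈ a ∷ [] → x ∈ filter (_≟ a) elements
      from (here refl) = ∈-filter⁺ (_≟ a) (complete a) refl

    count-image : {P : Pred A ℓ} {Q : Pred A ℓ′} (P? : Decidable P) (Q? : Decidable Q) (g : A → A) →
      (∀ {x y} → g x ≡ g y → x ≡ y) → (∀ {x} → P x → Q (g x)) → (∀ {y} → Q y → ∃ λ x → P x × y ≡ g x) →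
      count P? ≡ count Q?
    count-image P? Q? g g-injective P⇒Q Q⇒P = trans (sym (length-map g (filter P? elements)))
      (↭-length (↭-of-same-elements (Unique.map⁺ g-injective (Unique.filter⁺ P? distinct))
                                    (Unique.filter⁺ Q? distinct) to from))
      where
      to : ∀ {y} → y ∈ map g (filter P? elements) → y ∈ filter Q? elements
      to y∈ with x , x∈ , refl ← ∈-map⁻ g y∈ =
        ∈-filter⁺ Q? (complete (g x)) (P⇒Q (proj₂ (∈-filter⁻ P? {xs = elements} x∈)))
      from : ∀ {y} → y ∈ filter Q? elements → y ∈ map g (filter P? elements)
      from y∈ with x , px , refl ← Q⇒P (proj₂ (∈-filter⁻ Q? {xs = elements} y∈)) =
        ∈-map⁺ g (∈-filter⁺ P? (complete x) px)

    module Involution (σ : A → A) (σσ : ∀ x → σ (σ x) ≡ x) where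

      Fixed? : Decidable (λ x → σ x ≡ x)
      Fixed? x = σ x ≟ x

      Ascending? : Decidable (λ x → x ≺ σ x)
      Ascending? x = x ≺? σ x

      σ-injective : ∀ {x y} → σ x ≡ σ y → x ≡ y
      σ-injective {x} {y} eq = trans (sym (σσ x)) (trans (cong σ eq) (σσ y))

      -- The points moved by σ come in pairs {x , σ x}, each counted once by its ascending member.
      count-involution : {P : Pred A ℓ} (P? : Decidable P) → (∀ {x} → P x → P (σ x)) →
        count P? ≡ count (P? ∩? Fixed?) + 2 * count (P? ∩? Ascending?)
      count-involution {P = P} P? P-σ = begin
        count P?
          ≡⟨ count-∩∁ P? Fixed? ⟩
        fixed + count Moved?
          ≡⟨ cong (fixed +_) (count-∩∁ Moved? Ascending?) ⟩
        fixed + (count (Moved? ∩? Ascending?) + count (Moved? ∩? ∁? Ascending?))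
          ≡⟨ cong₂ (λ m n → fixed + (m + n))
               (count-≐ (Moved? ∩? Ascending?) (P? ∩? Ascending?) (moved-ascending , ascending-moved))
               (count-image (Moved? ∩? ∁? Ascending?) (P? ∩? Ascending?) σ σ-injective descending⇒σ-ascending ascending⇒σ-of-descending) ⟩
        fixed + (ascending + ascending)
          ≡⟨ cong (λ n → fixed + (ascending + n)) (sym (+-identityʳ ascending)) ⟩
        fixed + 2 * ascending
          ∎
        where
        open ≡-Reasoning
        Moved? = P? ∩? ∁? Fixed?
        fixed = count (P? ∩? Fixed?)
        ascending = count (P? ∩? Ascending?)
        moved-ascending : ∀ {x} → (P x × σ x ≢ x) × x ≺ σ x → P x × x ≺ σ x
        moved-ascending ((px , _) , x≺σx) = px , x≺σx
        ascending-moved : ∀ {x} → P x × x ≺ σ x → (P x × σ x ≢ x) × x ≺ σ x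
        ascending-moved {x} (px , x≺σx) = (px , λ σx≡x → ≺-irrefl x (subst (x ≺_) σx≡x x≺σx)) , x≺σx
        descending⇒σ-ascending : ∀ {x} → (P x × σ x ≢ x) × ¬ x ≺ σ x → P (σ x) × σ x ≺ σ (σ x)
        descending⇒σ-ascending {x} ((px , σx≢x) , x⊀σx) =
          P-σ px , subst (σ x ≺_) (sym (σσ x)) (≺-connex (σx≢x ∘ sym) x⊀σx)
        ascending⇒σ-of-descending : ∀ {y} → P y × y ≺ σ y → ∃ λ x → ((P x × σ x ≢ x) × ¬ x ≺ σ x) × y ≡ σ x
        ascending⇒σ-of-descending {y} (py , y≺σy) =
          σ y , ((P-σ py , λ σσy≡σy → ≺-irrefl y (subst (y ≺_) (trans (sym σσy≡σy) (σσ y)) y≺σy)) ,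
                 ≺-asym (subst (_≺ σ y) (sym (σσ y)) y≺σy)) , sym (σσ y)

      count-involution-unique-fixed : {P : Pred A ℓ} (P? : Decidable P) → (∀ {x} → P x → P (σ x)) →
        ∀ c → P c → σ c ≡ c → (∀ {x} → P x → σ x ≡ x → x ≡ c) →
        count P? ≡ 1 + 2 * count (P? ∩? Ascending?)
      count-involution-unique-fixed P? P-σ c pc σc≡c unique = trans (count-involution P? P-σ)
        (cong (_+ 2 * count (P? ∩? Ascending?))
              (trans (count-≐ (P? ∩? Fixed?) (_≟ c) ((λ (px , fixed) → unique px fixed) , λ { refl → pc , σc≡c }))
                     (count-≡ c)))

module Arithmetic where
  open import Data.Nat using (_+_; _*_; _/_)
  open import Data.Nat.Properties using (+-comm; *-comm; *-assoc)
  open import Data.Nat.Divisibility using (_∣_; ∣m+n∣m⇒∣n; ∣1⇒≡1; m∣m*n)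
  open import Data.Nat.DivMod using (m≡m%n+[m/n]*n; [m+kn]%n≡m%n)
  open import Data.Nat.Tactic.RingSolver using (solve-∀)
  open import Function using (_∘_)
  open import Relation.Nullary using (¬_; contradiction)
  open import Relation.Binary.PropositionalEquality

  odd-1+2* : ∀ m → ¬ 2 ∣ 1 + 2 * m
  odd-1+2* m 2∣1+2m = contradiction (∣1⇒≡1 (∣m+n∣m⇒∣n (subst (2 ∣_) (+-comm 1 (2 * m)) 2∣1+2m) (m∣m*n m))) λ ()

  ≡1-mod-4⇒odd : ∀ n → n % 4 ≡ 1 → ¬ 2 ∣ n
  ≡1-mod-4⇒odd n n%4≡1 = subst (¬_ ∘ (2 ∣_)) (sym n≡1+2[2k]) (odd-1+2* (2 * (n / 4)))
    where
    n≡1+2[2k] : n ≡ 1 + 2 * (2 * (n / 4))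
    n≡1+2[2k] = trans (m≡m%n+[m/n]*n n 4) (cong₂ _+_ n%4≡1 (trans (*-comm (n / 4) 4) (*-assoc 2 2 (n / 4))))

  ≡1-mod-4⇒≢1+2[1+2m] : ∀ n m → n % 4 ≡ 1 → n ≢ 1 + 2 * (1 + 2 * m)
  ≡1-mod-4⇒≢1+2[1+2m] n m n%4≡1 refl =
    contradiction (trans (sym ([m+kn]%n≡m%n 3 m 4)) (trans (cong (_% 4) (3+m*4 m)) n%4≡1)) λ ()
    where
    3+m*4 : ∀ m → 3 + m * 4 ≡ 1 + 2 * (1 + 2 * m)
    3+m*4 = solve-∀

module FieldTheory (K : FiniteField) where
  open import Level using (0ℓ)
  import Data.Nat as ℕ
  import Data.Nat.Properties as ℕ
  open import Data.Nat.Divisibility using (_∣_; m∣m*n)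
  open import Data.Product using (∃; _×_; _,_; proj₁; proj₂)
  open import Data.Sum using (_⊎_; inj₁; inj₂)
  import Data.Sum
  open import Data.Unit using (tt)
  open import Function using (_∘_; id)
  open import Relation.Nullary using (¬_; Dec; yes; no; contradiction; ¬?)
  open import Relation.Nullary.Decidable using (decidable-stable)
  open import Relation.Unary using (Decidable)
  open import Relation.Unary.Properties using (U?; _∩?_)
  import Algebra.Properties.Ring as RingProperties
  open import Relation.Binary.PropositionalEquality
  open Counting
  open Arithmetic

  open FiniteField K
  open PG2 K using (2F; IsSquare)

  ring : CommutativeRing 0ℓ 0ℓ
  ring = record { isCommutativeRing = isCommutativeRing }

  open CommutativeRing ring public using (_-_; +-identityˡ; *-comm; *-identityˡ; *-identityʳ; zeroˡ; zeroʳ; -‿inverseʳ)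
  open RingProperties (CommutativeRing.ring ring) public using (-0#≈0#; -‿involutive)
  open IntegerCoefficientSolver ring public
  open Enumeration elements complete distinct public
  open ≡-Reasoning

  1≢0 : 1F ≢ 0F
  1≢0 = 0≢1 ∘ sym

  -- 0F ⁻¹ is 0F.
  infix 25 _⁻¹
  _⁻¹ : F → F
  x ⁻¹ with x ≟ 0F
  ... | yes _ = 0F
  ... | no x≢0 = proj₁ (inverse x x≢0)

  *-inverseʳ : ∀ {x} → x ≢ 0F → x * x ⁻¹ ≡ 1F
  *-inverseʳ {x} x≢0 with x ≟ 0F
  ... | yes x≡0 = contradiction x≡0 x≢0
  ... | no x≢0′ = proj₂ (inverse x x≢0′)

  *-cancelˡ : ∀ {x y z} → x ≢ 0F → x * y ≡ x * z → y ≡ z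
  *-cancelˡ {x} {y} {z} x≢0 xy≡xz = begin
    y                  ≡⟨ *-identityˡ y ⟨
    1F * y             ≡⟨ cong (_* y) (*-inverseʳ x≢0) ⟨
    (x * x ⁻¹) * y     ≡⟨ solve 3 (λ x x′ y → (x :* x′) :* y := x′ :* (x :* y)) refl x (x ⁻¹) y ⟩
    x ⁻¹ * (x * y)     ≡⟨ cong (x ⁻¹ *_) xy≡xz ⟩
    x ⁻¹ * (x * z)     ≡⟨ solve 3 (λ x x′ z → x′ :* (x :* z) := (x :* x′) :* z) refl x (x ⁻¹) z ⟩
    (x * x ⁻¹) * z     ≡⟨ cong (_* z) (*-inverseʳ x≢0) ⟩
    1F * z             ≡⟨ *-identityˡ z ⟩
    z                  ∎

  x*y≡0⇒y≡0 : ∀ {x y} → x ≢ 0F → x * y ≡ 0F → y ≡ 0F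
  x*y≡0⇒y≡0 {x} x≢0 xy≡0 = *-cancelˡ x≢0 (trans xy≡0 (sym (zeroʳ x)))

  *-≢0 : ∀ {x y} → x ≢ 0F → y ≢ 0F → x * y ≢ 0F
  *-≢0 x≢0 y≢0 = y≢0 ∘ x*y≡0⇒y≡0 x≢0

  ⁻¹-≢0 : ∀ {x} → x ≢ 0F → x ⁻¹ ≢ 0F
  ⁻¹-≢0 {x} x≢0 x⁻¹≡0 = 1≢0 (trans (sym (*-inverseʳ x≢0)) (trans (cong (x *_) x⁻¹≡0) (zeroʳ x)))

  ⁻¹-unique : ∀ {x y} → x * y ≡ 1F → x ⁻¹ ≡ y
  ⁻¹-unique {x} {y} xy≡1 = *-cancelˡ x≢0 (trans (*-inverseʳ x≢0) (sym xy≡1))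
    where
    x≢0 : x ≢ 0F
    x≢0 x≡0 = 1≢0 (trans (sym xy≡1) (trans (cong (_* y) x≡0) (trans (*-comm 0F y) (zeroʳ y))))

  x-y≡0⇒x≡y : ∀ {x y} → x - y ≡ 0F → x ≡ y
  x-y≡0⇒x≡y {x} {y} x-y≡0 = begin
    x              ≡⟨ solve 2 (λ x y → x := (x :- y) :+ y) refl x y ⟩
    (x - y) + y    ≡⟨ cong (_+ y) x-y≡0 ⟩
    0F + y         ≡⟨ +-identityˡ y ⟩
    y              ∎

  square-± : ∀ {x y} → x * x ≡ y * y → x ≡ y ⊎ x ≡ - y
  square-± {x} {y} x²≡y² with x + y ≟ 0F
  ... | yes x+y≡0 = inj₂ (x-y≡0⇒x≡y (trans (solve 2 (λ x y → x :- (:- y) := x :+ y) refl x y) x+y≡0))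
  ... | no x+y≢0 = inj₁ (x-y≡0⇒x≡y (x*y≡0⇒y≡0 x+y≢0 (begin
    (x + y) * (x - y)  ≡⟨ solve 2 (λ x y → (x :+ y) :* (x :- y) := x :* x :- y :* y) refl x y ⟩
    x * x - y * y      ≡⟨ cong (_- y * y) x²≡y² ⟩
    y * y - y * y      ≡⟨ -‿inverseʳ (y * y) ⟩
    0F                 ∎)))

  proportional : ∀ {a b a′ b′} → b ≢ 0F → b * a′ ≡ b′ * a → a′ ≡ (a * b ⁻¹) * b′
  proportional {a} {b} {a′} {b′} b≢0 ba′≡b′a = *-cancelˡ b≢0 (begin
    b * a′                  ≡⟨ ba′≡b′a ⟩
    b′ * a                  ≡⟨ solve 2 (λ a b′ → b′ :* a := κ 1 :* a :* b′) refl a b′ ⟩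
    1F * a * b′             ≡⟨ cong (λ e → e * a * b′) (sym (*-inverseʳ b≢0)) ⟩
    b * b ⁻¹ * a * b′       ≡⟨ solve 4 (λ a b b′ i → b :* i :* a :* b′ := b :* ((a :* i) :* b′)) refl a b b′ (b ⁻¹) ⟩
    b * ((a * b ⁻¹) * b′)   ∎)

  IsSquare? : Decidable IsSquare
  IsSquare? d = search (λ x → x * x ≟ d)

  Nonsquare? : Decidable (¬_ ∘ IsSquare)
  Nonsquare? d = ¬? (IsSquare? d)

  NonZero? : Decidable (_≢ 0F)
  NonZero? x = ¬? (x ≟ 0F)

  IsSquare-cancel : ∀ {c d} → c ≢ 0F → IsSquare (c * c * d) → IsSquare d
  IsSquare-cancel {c} {d} c≢0 (w , w²≡c²d) = w * c ⁻¹ , (begin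
    (w * c ⁻¹) * (w * c ⁻¹)       ≡⟨ solve 2 (λ w c′ → (w :* c′) :* (w :* c′) := (w :* w) :* (c′ :* c′)) refl w (c ⁻¹) ⟩
    (w * w) * (c ⁻¹ * c ⁻¹)       ≡⟨ cong (_* (c ⁻¹ * c ⁻¹)) w²≡c²d ⟩
    (c * c * d) * (c ⁻¹ * c ⁻¹)
      ≡⟨ solve 3 (λ c d c′ → (c :* c :* d) :* (c′ :* c′) := (c :* c′) :* (c :* c′) :* d) refl c d (c ⁻¹) ⟩
    (c * c ⁻¹) * (c * c ⁻¹) * d   ≡⟨ cong (λ e → e * e * d) (*-inverseʳ c≢0) ⟩
    1F * 1F * d                   ≡⟨ solve 1 (λ d → κ 1 :* κ 1 :* d := d) refl d ⟩
    d                             ∎)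

  module Order≡1Mod4 (q≡1 : order % 4 ≡ 1) where

    -- Otherwise x ↦ x + 1F would be an involution without fixed points, and q would be even.
    2≢0 : 2F ≢ 0F
    2≢0 2≡0 = ≡1-mod-4⇒odd order q≡1 (subst (2 ∣_) (sym q≡2k) (m∣m*n (count (U? ∩? Ascending?))))
      where
      x+1+1≡x : ∀ x → (x + 1F) + 1F ≡ x
      x+1+1≡x x = begin
        (x + 1F) + 1F  ≡⟨ solve 1 (λ x → (x :+ κ 1) :+ κ 1 := x :+ κ 2) refl x ⟩
        x + 2F         ≡⟨ cong (x +_) 2≡0 ⟩
        x + 0F         ≡⟨ solve 1 (λ x → x :+ κ 0 := x) refl x ⟩
        x              ∎
      x+1≢x : ∀ x → x + 1F ≢ x
      x+1≢x x x+1≡x = 1≢0 (trans (solve 1 (λ x → κ 1 := (x :+ κ 1) :- x) refl x)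
                                 (trans (cong (_- x) x+1≡x) (-‿inverseʳ x)))
      open Involution (_+ 1F) x+1+1≡x
      q≡2k : order ≡ 2 ℕ.* count (U? ∩? Ascending?)
      q≡2k = begin
        order
          ≡⟨ count-all U? (λ _ → tt) ⟨
        count U?
          ≡⟨ count-involution U? (λ _ → tt) ⟩
        count (U? ∩? Fixed?) ℕ.+ 2 ℕ.* count (U? ∩? Ascending?)
          ≡⟨ cong (ℕ._+ 2 ℕ.* count (U? ∩? Ascending?)) (count-none (U? ∩? Fixed?) (λ x → x+1≢x x ∘ proj₂)) ⟩
        2 ℕ.* count (U? ∩? Ascending?)
          ∎

    -x≡x⇒x≡0 : ∀ {x} → - x ≡ x → x ≡ 0F
    -x≡x⇒x≡0 {x} -x≡x = x*y≡0⇒y≡0 2≢0 (begin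
      2F * x    ≡⟨ solve 1 (λ x → κ 2 :* x := x :+ x) refl x ⟩
      x + x     ≡⟨ cong (x +_) (sym -x≡x) ⟩
      x - x     ≡⟨ -‿inverseʳ x ⟩
      0F        ∎)

    -- Exactly one of x and - x is canonical when x ≢ 0.
    Canonical : F → Set
    Canonical x = x ≺ - x

    Canonical? : Decidable Canonical
    Canonical? x = x ≺? - x

    canonical⇒≢0 : ∀ {x} → Canonical x → x ≢ 0F
    canonical⇒≢0 {x} x≺-x refl = ≺-irrefl 0F (subst (0F ≺_) -0#≈0# x≺-x)

    canon : F → F
    canon y with Canonical? y
    ... | yes _ = y
    ... | no _ = - y

    canon-± : ∀ y → canon y ≡ y ⊎ canon y ≡ - y
    canon-± y with Canonical? y
    ... | yes _ = inj₁ refl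
    ... | no _ = inj₂ refl

    canon-canonical : ∀ {y} → y ≢ 0F → Canonical (canon y)
    canon-canonical {y} y≢0 with Canonical? y
    ... | yes y≺-y = y≺-y
    ... | no y⊀-y = subst (- y ≺_) (sym (-‿involutive y)) (≺-connex (y≢0 ∘ -x≡x⇒x≡0 ∘ sym) y⊀-y)

    canon-unique : ∀ {x y} → Canonical x → y ≡ x ⊎ y ≡ - x → canon y ≡ x
    canon-unique {x} x≺-x (inj₁ refl) with Canonical? x
    ... | yes _ = refl
    ... | no x⊀-x = contradiction x≺-x x⊀-x
    canon-unique {x} x≺-x (inj₂ refl) with Canonical? (- x)
    ... | yes -x≺--x = contradiction (subst (- x ≺_) (-‿involutive x) -x≺--x) (≺-asym x≺-x)
    ... | no _ = -‿involutive x

    canon-square : ∀ y → canon y * canon y ≡ y * y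
    canon-square y with canon-± y
    ... | inj₁ c≡y = cong (λ c → c * c) c≡y
    ... | inj₂ c≡-y = trans (cong (λ c → c * c) c≡-y) (solve 1 (λ y → (:- y) :* (:- y) := y :* y) refl y)

    module Negation = Involution -_ -‿involutive

    order≡1+2*count-canonical : order ≡ 1 ℕ.+ 2 ℕ.* count Canonical?
    order≡1+2*count-canonical = begin
      order                                ≡⟨ count-all U? (λ _ → tt) ⟨
      count U?
        ≡⟨ Negation.count-involution-unique-fixed U? (λ _ → tt) 0F tt -0#≈0# (λ _ → -x≡x⇒x≡0) ⟩
      1 ℕ.+ 2 ℕ.* count (U? ∩? Canonical?)
        ≡⟨ cong (λ n → 1 ℕ.+ 2 ℕ.* n) (count-≐ (U? ∩? Canonical?) Canonical? (proj₂ , (tt ,_))) ⟩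
      1 ℕ.+ 2 ℕ.* count Canonical?         ∎

    count-nonzero≡2*count-canonical : count NonZero? ≡ 2 ℕ.* count Canonical?
    count-nonzero≡2*count-canonical = begin
      count NonZero?
        ≡⟨ Negation.count-involution NonZero? (λ x≢0 → x≢0 ∘ -x≡0⇒x≡0) ⟩
      count (NonZero? ∩? Negation.Fixed?) ℕ.+ 2 ℕ.* count (NonZero? ∩? Canonical?)
        ≡⟨ cong₂ (λ m n → m ℕ.+ 2 ℕ.* n)
             (count-none (NonZero? ∩? Negation.Fixed?) (λ _ (x≢0 , -x≡x) → x≢0 (-x≡x⇒x≡0 -x≡x)))
             (count-≐ (NonZero? ∩? Canonical?) Canonical? (proj₂ , λ c → canonical⇒≢0 c , c)) ⟩
      2 ℕ.* count Canonical?
        ∎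
      where
      -x≡0⇒x≡0 : ∀ {x} → - x ≡ 0F → x ≡ 0F
      -x≡0⇒x≡0 {x} -x≡0 = trans (sym (-‿involutive x)) (trans (cong -_ -x≡0) -0#≈0#)

    count-affine : ∀ {ℓ} {P : F → Set ℓ} (P? : Decidable P) {u} x → u ≢ 0F →
      count (λ a → P? (x - 2F * u * a)) ≡ count P?
    count-affine {P = P} P? {u} x u≢0 = count-image (λ a → P? (x - 2F * u * a)) P? (λ a → x - 2F * u * a) injective id surjective
      where
      2u≢0 = *-≢0 2≢0 u≢0
      injective : ∀ {a b} → x - 2F * u * a ≡ x - 2F * u * b → a ≡ b
      injective {a} {b} eq = *-cancelˡ 2u≢0 (begin
        2F * u * a                            ≡⟨ solve 3 (λ x m a → m :* a := x :- (x :- m :* a)) refl x (2F * u) a ⟩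
        x - (x - 2F * u * a)                  ≡⟨ cong (λ e → x - e) eq ⟩
        x - (x - 2F * u * b)                  ≡⟨ solve 3 (λ x m b → x :- (x :- m :* b) := m :* b) refl x (2F * u) b ⟩
        2F * u * b                            ∎)
      surjective : ∀ {b} → P b → ∃ λ a → P (x - 2F * u * a) × b ≡ x - 2F * u * a
      surjective {b} pb = a , subst P b≡ pb , b≡
        where
        a = (x - b) * (2F * u) ⁻¹
        b≡ : b ≡ x - 2F * u * a
        b≡ = begin
          b                                          ≡⟨ solve 2 (λ x b → b := x :- κ 1 :* (x :- b)) refl x b ⟩
          x - 1F * (x - b)                           ≡⟨ cong (λ e → x - e * (x - b)) (*-inverseʳ 2u≢0) ⟨
          x - 2F * u * (2F * u) ⁻¹ * (x - b)
            ≡⟨ solve 4 (λ x b m i → x :- m :* i :* (x :- b) := x :- m :* ((x :- b) :* i)) refl x b (2F * u) ((2F * u) ⁻¹) ⟩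
          x - 2F * u * ((x - b) * (2F * u) ⁻¹)       ∎

    -- b ↦ - b pairs up the b ≢ 0, so the parity is decided by b = 0 alone.
    odd-count-nonsquare : ∀ c → ¬ IsSquare (- c) → ¬ 2 ∣ count (λ b → Nonsquare? (b * b - c))
    odd-count-nonsquare c -c-nonsquare =
      subst (¬_ ∘ (2 ∣_)) (sym count≡1+2k) (odd-1+2* (count (P? ∩? Negation.Ascending?)))
      where
      P? = λ b → Nonsquare? (b * b - c)
      count≡1+2k = Negation.count-involution-unique-fixed P?
        (λ {b} → subst (¬_ ∘ IsSquare) (cong (_- c) (sym (solve 1 (λ b → (:- b) :* (:- b) := b :* b) refl b))))
        0F (subst (¬_ ∘ IsSquare) (solve 1 (λ c → :- c := κ 0 :* κ 0 :- c) refl c) -c-nonsquare) -0#≈0# (λ _ → -x≡x⇒x≡0)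

    -- If -1 were a non-square, x ↦ canon (x ⁻¹) would be an involution of the canonical elements
    -- whose only fixed point is canon 1F: a fixed point has x * x ≡ 1F or x * x ≡ - 1F.
    module CanonicalInverse (-1-nonsquare : ¬ IsSquare (- 1F)) where

      ρ : F → F
      ρ x with Canonical? x
      ... | yes _ = canon (x ⁻¹)
      ... | no _ = x

      ρ-canonical : ∀ {x} → Canonical x → ρ x ≡ canon (x ⁻¹)
      ρ-canonical {x} x-canonical with Canonical? x
      ... | yes _ = refl
      ... | no ¬x-canonical = contradiction x-canonical ¬x-canonical

      ρ-noncanonical : ∀ {x} → ¬ Canonical x → ρ x ≡ x
      ρ-noncanonical {x} ¬x-canonical with Canonical? x
      ... | yes x-canonical = contradiction x-canonical ¬x-canonical
      ... | no _ = refl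

      ρ-preserves : ∀ {x} → Canonical x → Canonical (ρ x)
      ρ-preserves x-canonical =
        subst Canonical (sym (ρ-canonical x-canonical)) (canon-canonical (⁻¹-≢0 (canonical⇒≢0 x-canonical)))

      ⁻¹-± : ∀ {x z} → x ≢ 0F → z ≡ x ⁻¹ ⊎ z ≡ - x ⁻¹ → z ⁻¹ ≡ x ⊎ z ⁻¹ ≡ - x
      ⁻¹-± {x} x≢0 (inj₁ refl) = inj₁ (⁻¹-unique (trans (*-comm (x ⁻¹) x) (*-inverseʳ x≢0)))
      ⁻¹-± {x} x≢0 (inj₂ refl) =
        inj₂ (⁻¹-unique (trans (solve 2 (λ x x′ → (:- x′) :* (:- x) := x :* x′) refl x (x ⁻¹)) (*-inverseʳ x≢0)))

      ρ-involutive : ∀ x → ρ (ρ x) ≡ x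
      ρ-involutive x = by-cases (Canonical? x)
        where
        by-cases : Dec (Canonical x) → ρ (ρ x) ≡ x
        by-cases (no ¬x-canonical) = trans (cong ρ (ρ-noncanonical ¬x-canonical)) (ρ-noncanonical ¬x-canonical)
        by-cases (yes x-canonical) = begin
          ρ (ρ x)               ≡⟨ cong ρ (ρ-canonical x-canonical) ⟩
          ρ (canon (x ⁻¹))      ≡⟨ ρ-canonical (canon-canonical (⁻¹-≢0 x≢0)) ⟩
          canon (canon (x ⁻¹) ⁻¹) ≡⟨ canon-unique x-canonical (⁻¹-± x≢0 (canon-± (x ⁻¹))) ⟩
          x                     ∎
          where x≢0 = canonical⇒≢0 x-canonical

      c : F
      c = canon 1F

      c-canonical : Canonical c
      c-canonical = canon-canonical 1≢0

      ρc≡c : ρ c ≡ c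
      ρc≡c = trans (ρ-canonical c-canonical) (canon-unique c-canonical (inj₁ (⁻¹-unique c*c≡1)))
        where
        c*c≡1 : c * c ≡ 1F
        c*c≡1 = trans (canon-square 1F) (*-identityʳ 1F)

      ρ-fixed : ∀ {x} → Canonical x → ρ x ≡ x → x ≡ c
      ρ-fixed {x} x-canonical ρx≡x with canon-± (x ⁻¹)
      ... | inj₁ canon≡x⁻¹ = sym (canon-unique x-canonical (Data.Sum.map sym 1≡-x (square-± x*x≡1*1)))
        where
        x⁻¹≡x = trans (sym canon≡x⁻¹) (trans (sym (ρ-canonical x-canonical)) ρx≡x)
        x*x≡1*1 : x * x ≡ 1F * 1F
        x*x≡1*1 = trans (cong (x *_) (sym x⁻¹≡x)) (trans (*-inverseʳ (canonical⇒≢0 x-canonical)) (sym (*-identityʳ 1F)))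
        1≡-x : x ≡ - 1F → 1F ≡ - x
        1≡-x x≡-1 = trans (sym (-‿involutive 1F)) (cong -_ (sym x≡-1))
      ... | inj₂ canon≡-x⁻¹ = contradiction (x , x*x≡-1) -1-nonsquare
        where
        -x⁻¹≡x = trans (sym canon≡-x⁻¹) (trans (sym (ρ-canonical x-canonical)) ρx≡x)
        x*x≡-1 : x * x ≡ - 1F
        x*x≡-1 = begin
          x * x           ≡⟨ cong (x *_) (sym -x⁻¹≡x) ⟩
          x * - x ⁻¹      ≡⟨ solve 2 (λ x x′ → x :* (:- x′) := :- (x :* x′)) refl x (x ⁻¹) ⟩
          - (x * x ⁻¹)    ≡⟨ cong -_ (*-inverseʳ (canonical⇒≢0 x-canonical)) ⟩
          - 1F            ∎

      open Involution ρ ρ-involutive using (Ascending?; count-involution-unique-fixed)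

      count-canonical≡1+2k : ∃ λ k → count Canonical? ≡ 1 ℕ.+ 2 ℕ.* k
      count-canonical≡1+2k =
        count (Canonical? ∩? Ascending?) , count-involution-unique-fixed Canonical? ρ-preserves c c-canonical ρc≡c ρ-fixed

    -1-isSquare : IsSquare (- 1F)
    -1-isSquare = decidable-stable (IsSquare? (- 1F)) λ -1-nonsquare →
      let k , count≡1+2k = CanonicalInverse.count-canonical≡1+2k -1-nonsquare in
      ≡1-mod-4⇒≢1+2[1+2m] order k q≡1 (trans order≡1+2*count-canonical (cong (λ n → 1 ℕ.+ 2 ℕ.* n) count≡1+2k))

    -- If every element had a square root, canon ∘ root would map the nonzero elements
    -- bijectively onto the canonical ones, which are only half as many.
    module AllSquares (root : F → F) (root² : ∀ d → root d * root d ≡ d) where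

      count-nonzero≡count-canonical : count NonZero? ≡ count Canonical?
      count-nonzero≡count-canonical = count-image NonZero? Canonical? (canon ∘ root) injective to from
        where
        injective : ∀ {d e} → canon (root d) ≡ canon (root e) → d ≡ e
        injective {d} {e} eq = begin
          d                                ≡⟨ root² d ⟨
          root d * root d                  ≡⟨ canon-square (root d) ⟨
          canon (root d) * canon (root d)  ≡⟨ cong (λ y → y * y) eq ⟩
          canon (root e) * canon (root e)  ≡⟨ canon-square (root e) ⟩
          root e * root e                  ≡⟨ root² e ⟩
          e                                ∎
        to : ∀ {d} → d ≢ 0F → Canonical (canon (root d))
        to {d} d≢0 = canon-canonical λ root≡0 → d≢0 (trans (sym (root² d)) (trans (cong (λ y → y * y) root≡0) (zeroʳ 0F)))
        from : ∀ {x} → Canonical x → ∃ λ d → d ≢ 0F × x ≡ canon (root d)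
        from {x} x-canonical = x * x , *-≢0 x≢0 x≢0 , sym (canon-unique x-canonical (square-± (root² (x * x))))
          where x≢0 = canonical⇒≢0 x-canonical

      count-canonical≡0 : count Canonical? ≡ 0
      count-canonical≡0 = begin
        n          ≡⟨ ℕ.+-identityʳ n ⟨
        n ℕ.+ 0    ≡⟨ ℕ.+-cancelˡ-≡ n (n ℕ.+ 0) 0 n+n≡n+0 ⟩
        0          ∎
        where
        n = count Canonical?
        n+n≡n+0 : n ℕ.+ (n ℕ.+ 0) ≡ n ℕ.+ 0
        n+n≡n+0 = begin
          2 ℕ.* n          ≡⟨ count-nonzero≡2*count-canonical ⟨
          count NonZero?   ≡⟨ count-nonzero≡count-canonical ⟩
          n                ≡⟨ ℕ.+-identityʳ n ⟨
          n ℕ.+ 0          ∎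

    -- Opaque, since unfolding δ into this proof term makes type checking run out of memory.
    opaque
      ∃-nonsquare : ∃ (¬_ ∘ IsSquare)
      ∃-nonsquare = decidable-stable (search Nonsquare?) λ ¬nonsquare →
        let open AllSquares (λ d → proj₁ (square d ¬nonsquare)) (λ d → proj₂ (square d ¬nonsquare)) in
        ℕ.<⇒≢ (count-pos Canonical? (canon-canonical 1≢0)) (sym count-canonical≡0)
        where
        square : ∀ d → ¬ ∃ (¬_ ∘ IsSquare) → IsSquare d
        square d ¬nonsquare = decidable-stable (IsSquare? d) (¬nonsquare ∘ (d ,_))

    δ : F
    δ = proj₁ ∃-nonsquare

    δ-nonsquare : ¬ IsSquare δ
    δ-nonsquare = proj₂ ∃-nonsquare

    -δ-nonsquare : ¬ IsSquare (- δ)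
    -δ-nonsquare (w , w²≡-δ) = δ-nonsquare (i * w , (begin
      (i * w) * (i * w)   ≡⟨ solve 2 (λ i w → (i :* w) :* (i :* w) := (i :* i) :* (w :* w)) refl i w ⟩
      (i * i) * (w * w)   ≡⟨ cong₂ _*_ (proj₂ -1-isSquare) w²≡-δ ⟩
      - 1F * - δ          ≡⟨ solve 1 (λ δ → (:- κ 1) :* (:- δ) := δ) refl δ ⟩
      δ                   ∎))
      where i = proj₁ -1-isSquare

    -4δu²-nonsquare : ∀ {u} → u ≢ 0F → ¬ IsSquare (- (2F * 2F * (u * u) * δ))
    -4δu²-nonsquare {u} u≢0 square = -δ-nonsquare (IsSquare-cancel (*-≢0 2≢0 u≢0) (subst IsSquare
      (solve 2 (λ u δ → :- (κ 2 :* κ 2 :* (u :* u) :* δ) := (κ 2 :* u) :* (κ 2 :* u) :* (:- δ)) refl u δ) square))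

    δ≢0 : δ ≢ 0F
    δ≢0 δ≡0 = δ-nonsquare (0F , trans (zeroʳ 0F) (sym δ≡0))

module Geometry (K : FiniteField) (q≡1 : FiniteField.order K % 4 ≡ 1) where
  open import Data.Product using (∃; _,_; proj₁; proj₂)
  open import Data.List using (List; map; filter)
  open import Data.List.Properties using (map-++; length-map)
  open import Data.List.Relation.Unary.All as All using ()
  open import Data.List.Relation.Unary.All.Properties as All using (all-filter)
  import Data.List.Relation.Unary.AllPairs as AllPairs
  import Data.List.Relation.Unary.AllPairs.Properties as AllPairs
  open import Data.List.Relation.Binary.Permutation.Propositional using (_↭_)
  import Data.List.Relation.Binary.Permutation.Propositional.Properties as ↭
  open import Data.Nat.Divisibility using (_∣_)
  open import Function using (_∘_)
  open import Relation.Nullary using (¬_; yes; no; contradiction)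
  open import Relation.Nullary.Decidable using (decidable-stable)
  open import Relation.Unary using (Decidable)
  open import Relation.Unary.Properties using (∁?)
  open import Relation.Binary.PropositionalEquality
  open Counting
  open Arithmetic

  open FiniteField K
  open PG2 K
  open FieldTheory K
  open Order≡1Mod4 q≡1
  open ≡-Reasoning

  conicForm : Triple → F
  conicForm (a₀ , a₁ , a₂) = a₁ * a₁ - a₀ * a₂

  -- OnPerp P Q unfolds to polar (proj₁ Q) (proj₁ P) ≡ 0F.
  polar : Triple → Triple → F
  polar (a₀ , a₁ , a₂) (x , y , z) = a₀ * z + a₁ * (- (2F * y)) + a₂ * x

  -- Incident X L unfolds to proj₁ X · proj₁ L ≡ 0F.
  _·_ : Triple → Triple → F
  (a₀ , a₁ , a₂) · (b₀ , b₁ , b₂) = a₀ * b₀ + a₁ * b₁ + a₂ * b₂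

  -- [l₀,l₁,l₂] meets 𝒪 in the points (1,t,t²) with l₀ + l₁t + l₂t² = 0, and in (0,0,1) iff l₂ = 0.
  lineDisc : Triple → F
  lineDisc (l₀ , l₁ , l₂) = l₁ * l₁ - 2F * 2F * l₀ * l₂

  _⨯_ : Triple → Triple → Triple
  (x₀ , x₁ , x₂) ⨯ (y₀ , y₁ , y₂) = (x₁ * y₂ - x₂ * y₁ , x₂ * y₀ - x₀ * y₂ , x₀ * y₁ - x₁ * y₀)

  0₃ : Triple
  0₃ = 0F , 0F , 0F

  lineDisc-⨯ : ∀ X Y → lineDisc (X ⨯ Y) ≡ polar X Y * polar X Y - 2F * 2F * conicForm X * conicForm Y
  lineDisc-⨯ (x₀ , x₁ , x₂) (y₀ , y₁ , y₂) = solve 6 (λ x₀ x₁ x₂ y₀ y₁ y₂ →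
    let l₀ = x₁ :* y₂ :- x₂ :* y₁ ; l₁ = x₂ :* y₀ :- x₀ :* y₂ ; l₂ = x₀ :* y₁ :- x₁ :* y₀
        p = x₀ :* y₂ :+ x₁ :* (:- (κ 2 :* y₁)) :+ x₂ :* y₀ in
    l₁ :* l₁ :- κ 2 :* κ 2 :* l₀ :* l₂ := p :* p :- κ 2 :* κ 2 :* (x₁ :* x₁ :- x₀ :* x₂) :* (y₁ :* y₁ :- y₀ :* y₂))
    refl x₀ x₁ x₂ y₀ y₁ y₂

  ·-scaleˡ : ∀ k x l → scale k x · l ≡ k * (x · l)
  ·-scaleˡ k (x₀ , x₁ , x₂) (l₀ , l₁ , l₂) = solve 7 (λ k x₀ x₁ x₂ l₀ l₁ l₂ →
    (k :* x₀) :* l₀ :+ (k :* x₁) :* l₁ :+ (k :* x₂) :* l₂ := k :* (x₀ :* l₀ :+ x₁ :* l₁ :+ x₂ :* l₂))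
    refl k x₀ x₁ x₂ l₀ l₁ l₂

  polar-scaleʳ : ∀ k X Y → polar X (scale k Y) ≡ k * polar X Y
  polar-scaleʳ k (x₀ , x₁ , x₂) (y₀ , y₁ , y₂) = solve 7 (λ k x₀ x₁ x₂ y₀ y₁ y₂ →
    x₀ :* (k :* y₂) :+ x₁ :* (:- (κ 2 :* (k :* y₁))) :+ x₂ :* (k :* y₀)
      := k :* (x₀ :* y₂ :+ x₁ :* (:- (κ 2 :* y₁)) :+ x₂ :* y₀)) refl k x₀ x₁ x₂ y₀ y₁ y₂

  polar-scaleˡ : ∀ k X Y → polar (scale k X) Y ≡ k * polar X Y
  polar-scaleˡ k (x₀ , x₁ , x₂) (y₀ , y₁ , y₂) = solve 7 (λ k x₀ x₁ x₂ y₀ y₁ y₂ →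
    (k :* x₀) :* y₂ :+ (k :* x₁) :* (:- (κ 2 :* y₁)) :+ (k :* x₂) :* y₀
      := k :* (x₀ :* y₂ :+ x₁ :* (:- (κ 2 :* y₁)) :+ x₂ :* y₀)) refl k x₀ x₁ x₂ y₀ y₁ y₂

  conicForm-scale : ∀ k X → conicForm (scale k X) ≡ k * k * conicForm X
  conicForm-scale k (x₀ , x₁ , x₂) = solve 4 (λ k x₀ x₁ x₂ →
    (k :* x₁) :* (k :* x₁) :- (k :* x₀) :* (k :* x₂) := k :* k :* (x₁ :* x₁ :- x₀ :* x₂)) refl k x₀ x₁ x₂

  lineDisc-scale : ∀ k l → lineDisc (scale k l) ≡ k * k * lineDisc l
  lineDisc-scale k (l₀ , l₁ , l₂) = solve 4 (λ k l₀ l₁ l₂ →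
    (k :* l₁) :* (k :* l₁) :- κ 2 :* κ 2 :* (k :* l₀) :* (k :* l₂)
      := k :* k :* (l₁ :* l₁ :- κ 2 :* κ 2 :* l₀ :* l₂)) refl k l₀ l₁ l₂

  OnO⇒conicForm≡0 : ∀ X → OnO X → conicForm (proj₁ X) ≡ 0F
  OnO⇒conicForm≡0 _ (inj₁ (t , k , _ , refl)) = trans (conicForm-scale k (1F , t , t * t))
    (trans (cong (k * k *_) (solve 1 (λ t → t :* t :- κ 1 :* (t :* t) := κ 0) refl t)) (zeroʳ (k * k)))
  OnO⇒conicForm≡0 _ (inj₂ (k , _ , refl)) = trans (conicForm-scale k (0F , 0F , 1F))
    (trans (cong (k * k *_) (solve 0 (κ 0 :* κ 0 :- κ 0 :* κ 1 := κ 0) refl)) (zeroʳ (k * k)))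

  -- The points (0,0,1) and (1,t,t²) of 𝒪, scaled by 1F so that OnO holds by refl.
  vertex : Point
  vertex = scale 1F (0F , 0F , 1F) , λ (_ , _ , 1*1≡0) → 1≢0 (trans (sym (*-identityʳ 1F)) 1*1≡0)

  conicPoint : F → Point
  conicPoint t = scale 1F (1F , t , t * t) , λ (1*1≡0 , _) → 1≢0 (trans (sym (*-identityʳ 1F)) 1*1≡0)

  completing-square : ∀ l₀ l₁ l₂ t → (2F * l₂ * t + l₁) * (2F * l₂ * t + l₁)
    ≡ lineDisc (l₀ , l₁ , l₂) + 2F * 2F * l₂ * ((1F , t , t * t) · (l₀ , l₁ , l₂))
  completing-square l₀ l₁ l₂ t = solve 4 (λ l₀ l₁ l₂ t →
    (κ 2 :* l₂ :* t :+ l₁) :* (κ 2 :* l₂ :* t :+ l₁)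
      := (l₁ :* l₁ :- κ 2 :* κ 2 :* l₀ :* l₂) :+ κ 2 :* κ 2 :* l₂ :* (κ 1 :* l₀ :+ t :* l₁ :+ (t :* t) :* l₂))
    refl l₀ l₁ l₂ t

  nonsquare⇒passant : ∀ L → ¬ IsSquare (lineDisc (proj₁ L)) → Passant L
  nonsquare⇒passant ((l₀ , l₁ , l₂) , _) D-nonsquare _ (inj₁ (t , k , k≢0 , refl)) X·L≡0 =
    D-nonsquare (2F * l₂ * t + l₁ , (begin
      (2F * l₂ * t + l₁) * (2F * l₂ * t + l₁)           ≡⟨ completing-square l₀ l₁ l₂ t ⟩
      D + 2F * 2F * l₂ * ((1F , t , t * t) · l)
        ≡⟨ cong (λ e → D + 2F * 2F * l₂ * e) (x*y≡0⇒y≡0 k≢0 (trans (sym (·-scaleˡ k _ l)) X·L≡0)) ⟩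
      D + 2F * 2F * l₂ * 0F
        ≡⟨ solve 2 (λ D l₂ → D :+ κ 2 :* κ 2 :* l₂ :* κ 0 := D) refl D l₂ ⟩
      D                                                 ∎))
    where l = (l₀ , l₁ , l₂) ; D = lineDisc l
  nonsquare⇒passant ((l₀ , l₁ , l₂) , _) D-nonsquare _ (inj₂ (k , k≢0 , refl)) X·L≡0 =
    D-nonsquare (l₁ , (begin
      l₁ * l₁
        ≡⟨ solve 2 (λ l₀ l₁ → l₁ :* l₁ := l₁ :* l₁ :- κ 2 :* κ 2 :* l₀ :* κ 0) refl l₀ l₁ ⟩
      l₁ * l₁ - 2F * 2F * l₀ * 0F       ≡⟨ cong (λ e → l₁ * l₁ - 2F * 2F * l₀ * e) (sym l₂≡0) ⟩
      lineDisc (l₀ , l₁ , l₂)           ∎))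
    where
    l₂≡0 : l₂ ≡ 0F
    l₂≡0 = x*y≡0⇒y≡0 k≢0 (trans (solve 4 (λ k l₀ l₁ l₂ →
      k :* l₂ := (k :* κ 0) :* l₀ :+ (k :* κ 0) :* l₁ :+ (k :* κ 1) :* l₂) refl k l₀ l₁ l₂) X·L≡0)

  square⇒¬passant : ∀ L → IsSquare (lineDisc (proj₁ L)) → ¬ Passant L
  square⇒¬passant ((l₀ , l₁ , l₂) , _) (w , w²≡D) passant with l₂ ≟ 0F
  ... | yes l₂≡0 = passant vertex (inj₂ (1F , 1≢0 , refl)) (begin
    scale 1F (0F , 0F , 1F) · l    ≡⟨ ·-scaleˡ 1F (0F , 0F , 1F) l ⟩
    1F * ((0F , 0F , 1F) · l)
      ≡⟨ solve 3 (λ l₀ l₁ l₂ → κ 1 :* (κ 0 :* l₀ :+ κ 0 :* l₁ :+ κ 1 :* l₂) := l₂) refl l₀ l₁ l₂ ⟩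
    l₂                             ≡⟨ l₂≡0 ⟩
    0F                             ∎)
    where l = (l₀ , l₁ , l₂)
  ... | no l₂≢0 = passant (conicPoint t) (inj₁ (t , 1F , 1≢0 , refl))
      (trans (·-scaleˡ 1F _ l) (trans (cong (1F *_) tangent) (zeroʳ 1F)))
    where
    l = (l₀ , l₁ , l₂)
    -- The root t = (w − l₁) / 2l₂ of l₀ + l₁t + l₂t².
    t = (w - l₁) * (2F * l₂) ⁻¹
    2l₂t+l₁≡w : 2F * l₂ * t + l₁ ≡ w
    2l₂t+l₁≡w = begin
      2F * l₂ * ((w - l₁) * (2F * l₂) ⁻¹) + l₁
        ≡⟨ solve 4 (λ m i w l₁ → m :* ((w :- l₁) :* i) :+ l₁ := (m :* i) :* (w :- l₁) :+ l₁)
                   refl (2F * l₂) ((2F * l₂) ⁻¹) w l₁ ⟩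
      (2F * l₂ * (2F * l₂) ⁻¹) * (w - l₁) + l₁   ≡⟨ cong (λ e → e * (w - l₁) + l₁) (*-inverseʳ (*-≢0 2≢0 l₂≢0)) ⟩
      1F * (w - l₁) + l₁                         ≡⟨ solve 2 (λ w l₁ → κ 1 :* (w :- l₁) :+ l₁ := w) refl w l₁ ⟩
      w                                          ∎
    tangent : (1F , t , t * t) · l ≡ 0F
    tangent = x*y≡0⇒y≡0 (*-≢0 (*-≢0 2≢0 2≢0) l₂≢0) (begin
      2F * 2F * l₂ * ((1F , t , t * t) · l)
        ≡⟨ solve 2 (λ D e → e := (D :+ e) :- D) refl (lineDisc l) (2F * 2F * l₂ * ((1F , t , t * t) · l)) ⟩
      (lineDisc l + 2F * 2F * l₂ * ((1F , t , t * t) · l)) - lineDisc l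
        ≡⟨ cong (_- lineDisc l) (sym (completing-square l₀ l₁ l₂ t)) ⟩
      (2F * l₂ * t + l₁) * (2F * l₂ * t + l₁) - lineDisc l     ≡⟨ cong (λ e → e * e - lineDisc l) 2l₂t+l₁≡w ⟩
      w * w - lineDisc l                                       ≡⟨ cong (_- lineDisc l) w²≡D ⟩
      lineDisc l - lineDisc l                                  ≡⟨ -‿inverseʳ (lineDisc l) ⟩
      0F                                                       ∎)

  ⨯≡0⇒proportional : ∀ {u v} → NonZero u → u ⨯ v ≡ 0₃ → ∃ λ k → v ≡ scale k u
  ⨯≡0⇒proportional {u₀ , u₁ , u₂} {v₀ , v₁ , v₂} u≢0 u⨯v≡0
    with c₀ ← x-y≡0⇒x≡y (cong proj₁ u⨯v≡0)
       | c₁ ← x-y≡0⇒x≡y (cong (proj₁ ∘ proj₂) u⨯v≡0)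
       | c₂ ← x-y≡0⇒x≡y (cong (proj₂ ∘ proj₂) u⨯v≡0)
    with u₀ ≟ 0F | u₁ ≟ 0F | u₂ ≟ 0F
  ... | no u₀≢0 | _ | _ = v₀ * u₀ ⁻¹ ,
    cong₂ _,_ (proportional u₀≢0 refl) (cong₂ _,_ (proportional u₀≢0 c₂) (proportional u₀≢0 (sym c₁)))
  ... | yes _ | no u₁≢0 | _ = v₁ * u₁ ⁻¹ ,
    cong₂ _,_ (proportional u₁≢0 (sym c₂)) (cong₂ _,_ (proportional u₁≢0 refl) (proportional u₁≢0 c₀))
  ... | yes _ | yes _ | no u₂≢0 = v₂ * u₂ ⁻¹ ,
    cong₂ _,_ (proportional u₂≢0 c₁) (cong₂ _,_ (proportional u₂≢0 (sym c₀)) (proportional u₂≢0 refl))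
  ... | yes u₀≡0 | yes u₁≡0 | yes u₂≡0 = contradiction (u₀≡0 , u₁≡0 , u₂≡0) u≢0

  ·-⨯ˡ : ∀ x y → x · (x ⨯ y) ≡ 0F
  ·-⨯ˡ (x₀ , x₁ , x₂) (y₀ , y₁ , y₂) = solve 6 (λ x₀ x₁ x₂ y₀ y₁ y₂ →
    x₀ :* (x₁ :* y₂ :- x₂ :* y₁) :+ x₁ :* (x₂ :* y₀ :- x₀ :* y₂) :+ x₂ :* (x₀ :* y₁ :- x₁ :* y₀) := κ 0)
    refl x₀ x₁ x₂ y₀ y₁ y₂

  ·-⨯ʳ : ∀ x y → y · (x ⨯ y) ≡ 0F
  ·-⨯ʳ (x₀ , x₁ , x₂) (y₀ , y₁ , y₂) = solve 6 (λ x₀ x₁ x₂ y₀ y₁ y₂ →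
    y₀ :* (x₁ :* y₂ :- x₂ :* y₁) :+ y₁ :* (x₂ :* y₀ :- x₀ :* y₂) :+ y₂ :* (x₀ :* y₁ :- x₁ :* y₀) := κ 0)
    refl x₀ x₁ x₂ y₀ y₁ y₂

  -- By (x ⨯ y) ⨯ l = (x · l) y − (y · l) x.
  incident⇒⨯≡0 : ∀ x y l → x · l ≡ 0F → y · l ≡ 0F → (x ⨯ y) ⨯ l ≡ 0₃
  incident⇒⨯≡0 x@(x₀ , x₁ , x₂) y@(y₀ , y₁ , y₂) l@(l₀ , l₁ , l₂) x·l≡0 y·l≡0 =
    cong₂ _,_ (trans (solve 9 (λ x₀ x₁ x₂ y₀ y₁ y₂ l₀ l₁ l₂ →
                       (x₂ :* y₀ :- x₀ :* y₂) :* l₂ :- (x₀ :* y₁ :- x₁ :* y₀) :* l₁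
                         := y₀ :* (x₀ :* l₀ :+ x₁ :* l₁ :+ x₂ :* l₂) :- x₀ :* (y₀ :* l₀ :+ y₁ :* l₁ :+ y₂ :* l₂))
                       refl x₀ x₁ x₂ y₀ y₁ y₂ l₀ l₁ l₂) (vanish y₀ x₀))
   (cong₂ _,_ (trans (solve 9 (λ x₀ x₁ x₂ y₀ y₁ y₂ l₀ l₁ l₂ →
                       (x₀ :* y₁ :- x₁ :* y₀) :* l₀ :- (x₁ :* y₂ :- x₂ :* y₁) :* l₂
                         := y₁ :* (x₀ :* l₀ :+ x₁ :* l₁ :+ x₂ :* l₂) :- x₁ :* (y₀ :* l₀ :+ y₁ :* l₁ :+ y₂ :* l₂))
                       refl x₀ x₁ x₂ y₀ y₁ y₂ l₀ l₁ l₂) (vanish y₁ x₁))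
              (trans (solve 9 (λ x₀ x₁ x₂ y₀ y₁ y₂ l₀ l₁ l₂ →
                       (x₁ :* y₂ :- x₂ :* y₁) :* l₁ :- (x₂ :* y₀ :- x₀ :* y₂) :* l₀
                         := y₂ :* (x₀ :* l₀ :+ x₁ :* l₁ :+ x₂ :* l₂) :- x₂ :* (y₀ :* l₀ :+ y₁ :* l₁ :+ y₂ :* l₂))
                       refl x₀ x₁ x₂ y₀ y₁ y₂ l₀ l₁ l₂) (vanish y₂ x₂)))
    where
    vanish : ∀ a b → a * (x · l) - b * (y · l) ≡ 0F
    vanish a b = begin
      a * (x · l) - b * (y · l)   ≡⟨ cong₂ (λ e f → a * e - b * f) x·l≡0 y·l≡0 ⟩
      a * 0F - b * 0F             ≡⟨ solve 2 (λ a b → a :* κ 0 :- b :* κ 0 := κ 0) refl a b ⟩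
      0F                          ∎

  scale-0 : ∀ v → scale 0F v ≡ 0₃
  scale-0 (v₀ , v₁ , v₂) = cong₂ _,_ (zeroˡ v₀) (cong₂ _,_ (zeroˡ v₁) (zeroˡ v₂))

  join : (X Y : Point) → NonZero (proj₁ X ⨯ proj₁ Y) → Line
  join (x , _) (y , _) x⨯y≢0 = x ⨯ y , x⨯y≢0

  join-passant : ∀ X Y (x⨯y≢0 : NonZero (proj₁ X ⨯ proj₁ Y)) →
    ¬ IsSquare (lineDisc (proj₁ X ⨯ proj₁ Y)) → JoinPassant X Y
  join-passant (x , _) (y , _) x⨯y≢0 D-nonsquare L@(l , l≢0) x·l≡0 y·l≡0 = nonsquare⇒passant L λ D-square →
    D-nonsquare (IsSquare-cancel k≢0 (subst IsSquare (trans (cong lineDisc l≡kv) (lineDisc-scale k (x ⨯ y))) D-square))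
    where
    proportionality = ⨯≡0⇒proportional x⨯y≢0 (incident⇒⨯≡0 x y l x·l≡0 y·l≡0)
    k = proj₁ proportionality
    l≡kv = proj₂ proportionality
    k≢0 : k ≢ 0F
    k≢0 k≡0 = l≢0 (cong proj₁ l≡0 , cong (proj₁ ∘ proj₂) l≡0 , cong (proj₂ ∘ proj₂) l≡0)
      where l≡0 = trans l≡kv (trans (cong (λ k → scale k (x ⨯ y)) k≡0) (scale-0 (x ⨯ y)))

  join-¬passant : ∀ X Y (x⨯y≢0 : NonZero (proj₁ X ⨯ proj₁ Y)) →
    IsSquare (lineDisc (proj₁ X ⨯ proj₁ Y)) → ¬ JoinPassant X Y
  join-¬passant X@(x , _) Y@(y , _) x⨯y≢0 D-square X∨Y-passant =
    square⇒¬passant (join X Y x⨯y≢0) D-square (X∨Y-passant (join X Y x⨯y≢0) (·-⨯ˡ x y) (·-⨯ʳ x y))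

  nonzero-of-form : ∀ x → conicForm x ≢ 0F → NonZero x
  nonzero-of-form _ form≢0 (refl , refl , refl) = form≢0 (solve 0 (κ 0 :* κ 0 :- κ 0 :* κ 0 := κ 0) refl)

  -- If x ⨯ y vanished then y ∼ x, and the forms of x and y would lie in the same square class.
  ⨯-nonzero : ∀ x y → conicForm x ≢ 0F → IsSquare (conicForm x) → ¬ IsSquare (conicForm y) → NonZero (x ⨯ y)
  ⨯-nonzero x y x-form≢0 (w , w²≡x-form) y-form-nonsquare (e₀ , e₁ , e₂)
    with k , y≡kx ← ⨯≡0⇒proportional (nonzero-of-form x x-form≢0) (cong₂ _,_ e₀ (cong₂ _,_ e₁ e₂)) =
    y-form-nonsquare (k * w , (begin
      (k * w) * (k * w)       ≡⟨ solve 2 (λ k w → (k :* w) :* (k :* w) := k :* k :* (w :* w)) refl k w ⟩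
      k * k * (w * w)         ≡⟨ cong (k * k *_) w²≡x-form ⟩
      k * k * conicForm x     ≡⟨ conicForm-scale k x ⟨
      conicForm (scale k x)   ≡⟨ cong conicForm y≡kx ⟨
      conicForm y             ∎))

  oddCount-map : ∀ {ℓ} {P : F → Set ℓ} (P? : Decidable P) (f : F → Point) {Pr : Point → Set} →
    (∀ {a} → P a → Pr (f a)) → (∀ {a} → ¬ P a → ¬ Pr (f a)) → ¬ 2 ∣ count P? → OddCount Pr (map f elements)
  oddCount-map P? f P⇒Pr ¬P⇒¬Pr odd =
    map f (filter P? elements) , map f (filter (∁? P?) elements) ,
    subst (map f elements ↭_) (map-++ f (filter P? elements) _) (↭.map⁺ f (↭-filter-partition P? elements)) ,
    All.map⁺ (All.map P⇒Pr (all-filter P? elements)) ,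
    All.map⁺ (All.map ¬P⇒¬Pr (all-filter (∁? P?) elements)) ,
    subst (¬_ ∘ (2 ∣_)) (sym (length-map f (filter P? elements))) odd

  -- M(P) = {point a : a ∈ F} with point a = φ a − δ p, where φ parametrises 𝒪 ∖ {P} and
  -- polar (φ a) p ≡ 1F. The linear forms u and x give polar Q (point a) ≡ x Q − 2 u Q a on P^⊥.
  record InternalFamily (p : Triple) : Set where
    field
      point   : F → Triple
      u x     : Triple → F
      u-scale : ∀ k X → u (scale k X) ≡ k * u X
      u-point : ∀ a → u (point a) ≡ a
      polar-point-p : ∀ a → polar (point a) p ≡ 1F
      conicForm-point : ∀ a → conicForm (point a) ≡ δ
      polar-point : ∀ Q a → polar Q (point a) ≡ x Q - 2F * u Q * a + (a * a - δ) * polar Q p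
      conicForm-decomposition : ∀ Q → conicForm Q ≡ u Q * u Q - x Q * polar Q p

  module Family {p : Triple} (M : InternalFamily p) where
    open InternalFamily M

    member : F → Point
    member a = point a , nonzero-of-form (point a) (subst (_≢ 0F) (sym (conicForm-point a)) δ≢0)

    members : List Point
    members = map member elements

    member-internal : ∀ a → Internal (member a)
    member-internal a =
      (λ onO → δ≢0 (trans (sym (conicForm-point a)) (OnO⇒conicForm≡0 (member a) onO))) ,
      subst (¬_ ∘ IsSquare) (sym (conicForm-point a)) δ-nonsquare

    member-injective : ∀ {a b} → member a ∼ member b → a ≡ b
    member-injective {a} {b} (k , _ , φb≡kφa) = begin
      a                     ≡⟨ *-identityˡ a ⟨
      1F * a                ≡⟨ cong (_* a) (sym k≡1) ⟩
      k * a                 ≡⟨ cong (k *_) (u-point a) ⟨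
      k * u (point a)       ≡⟨ u-scale k (point a) ⟨
      u (scale k (point a)) ≡⟨ cong u φb≡kφa ⟨
      u (point b)           ≡⟨ u-point b ⟩
      b                     ∎
      where
      k≡1 : k ≡ 1F
      k≡1 = begin
        k                              ≡⟨ *-identityʳ k ⟨
        k * 1F                         ≡⟨ cong (k *_) (polar-point-p a) ⟨
        k * polar (point a) p          ≡⟨ polar-scaleˡ k (point a) p ⟨
        polar (scale k (point a)) p    ≡⟨ cong (λ X → polar X p) φb≡kφa ⟨
        polar (point b) p              ≡⟨ polar-point-p b ⟩
        1F                             ∎

    conicForm≡u² : ∀ q → polar q p ≡ 0F → conicForm q ≡ u q * u q
    conicForm≡u² q q⊥p = begin
      conicForm q                   ≡⟨ conicForm-decomposition q ⟩
      u q * u q - x q * polar q p   ≡⟨ cong (λ e → u q * u q - x q * e) q⊥p ⟩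
      u q * u q - x q * 0F          ≡⟨ solve 2 (λ u x → u :* u :- x :* κ 0 := u :* u) refl (u q) (x q) ⟩
      u q * u q                     ∎

    lineDisc-⨯-point : ∀ q a → polar q p ≡ 0F →
      lineDisc (q ⨯ point a) ≡ (x q - 2F * u q * a) * (x q - 2F * u q * a) - 2F * 2F * (u q * u q) * δ
    lineDisc-⨯-point q a q⊥p = begin
      lineDisc (q ⨯ point a)
        ≡⟨ lineDisc-⨯ q (point a) ⟩
      polar q (point a) * polar q (point a) - 2F * 2F * conicForm q * conicForm (point a)
        ≡⟨ cong₂ (λ e f → e * e - 2F * 2F * f * conicForm (point a)) polar≡ℓ (conicForm≡u² q q⊥p) ⟩
      ℓ * ℓ - 2F * 2F * (u q * u q) * conicForm (point a)
        ≡⟨ cong (λ e → ℓ * ℓ - 2F * 2F * (u q * u q) * e) (conicForm-point a) ⟩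
      ℓ * ℓ - 2F * 2F * (u q * u q) * δ
        ∎
      where
      ℓ = x q - 2F * u q * a
      polar≡ℓ : polar q (point a) ≡ ℓ
      polar≡ℓ = begin
        polar q (point a)                              ≡⟨ polar-point q a ⟩
        ℓ + (a * a - δ) * polar q p                    ≡⟨ cong (λ e → ℓ + (a * a - δ) * e) q⊥p ⟩
        ℓ + (a * a - δ) * 0F                           ≡⟨ solve 3 (λ ℓ a δ → ℓ :+ (a :* a :- δ) :* κ 0 := ℓ) refl ℓ a δ ⟩
        ℓ                                              ∎

    members-oddCount : ∀ Q → External Q → polar (proj₁ Q) p ≡ 0F → OddCount (JoinPassant Q) members
    members-oddCount Q@(q , _) (_ , form≢0 , form-square) q⊥p =
      oddCount-map (λ a → Nonsquare? (ℓ a * ℓ a - c)) member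
        (λ {a} ns → join-passant Q (member a) (cross≢0 a) (subst (¬_ ∘ IsSquare) (sym (lineDisc-⨯-point q a q⊥p)) ns))
        (λ {a} ¬ns → join-¬passant Q (member a) (cross≢0 a)
                       (subst IsSquare (sym (lineDisc-⨯-point q a q⊥p)) (decidable-stable (IsSquare? _) ¬ns)))
        (subst (¬_ ∘ (2 ∣_)) (sym (count-affine (λ b → Nonsquare? (b * b - c)) (x q) u≢0))
               (odd-count-nonsquare c (-4δu²-nonsquare u≢0)))
      where
      ℓ : F → F
      ℓ a = x q - 2F * u q * a
      c = 2F * 2F * (u q * u q) * δ
      u≢0 : u q ≢ 0F
      u≢0 u≡0 = form≢0 (trans (conicForm≡u² q q⊥p) (trans (cong (λ e → e * e) u≡0) (zeroʳ 0F)))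
      cross≢0 : ∀ a → NonZero (q ⨯ point a)
      cross≢0 a = ⨯-nonzero q (point a) form≢0 form-square (proj₂ (member-internal a))

    conclusion : ∀ {k} (nz : NonZero (scale k p)) → k ≢ 0F →
      ∃[ M ] (IsPointSet M × All Internal M × Odd (length M) ×
        (∀ Q → External Q → OnPerp (scale k p , nz) Q → OddCount (JoinPassant Q) M))
    conclusion {k} _ k≢0 =
      members ,
      AllPairs.map⁺ (AllPairs.map (λ a≢b → a≢b ∘ member-injective) distinct) ,
      All.map⁺ (All.tabulate λ {a} _ → member-internal a) ,
      subst Odd (sym (length-map member elements)) (≡1-mod-4⇒odd order q≡1) ,
      λ Q external Q⊥P → members-oddCount Q external (x*y≡0⇒y≡0 k≢0 (trans (sym (polar-scaleʳ k (proj₁ Q) p)) Q⊥P))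

  vertexFamily : InternalFamily (0F , 0F , 1F)
  vertexFamily = record
    { point = λ a → 1F , a , a * a - δ
    ; u = λ (_ , q₁ , _) → q₁
    ; x = λ (_ , _ , q₂) → q₂
    ; u-scale = λ _ _ → refl
    ; u-point = λ _ → refl
    ; polar-point-p = λ a → solve 2 (λ a δ → κ 1 :* κ 1 :+ a :* (:- (κ 2 :* κ 0)) :+ (a :* a :- δ) :* κ 0 := κ 1) refl a δ
    ; conicForm-point = λ a → solve 2 (λ a δ → a :* a :- κ 1 :* (a :* a :- δ) := δ) refl a δ
    ; polar-point = λ (q₀ , q₁ , q₂) a → solve 5 (λ q₀ q₁ q₂ a δ →
        q₀ :* (a :* a :- δ) :+ q₁ :* (:- (κ 2 :* a)) :+ q₂ :* κ 1
          := q₂ :- κ 2 :* q₁ :* a :+ (a :* a :- δ) :* (q₀ :* κ 1 :+ q₁ :* (:- (κ 2 :* κ 0)) :+ q₂ :* κ 0)) refl q₀ q₁ q₂ a δ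
    ; conicForm-decomposition = λ (q₀ , q₁ , q₂) → solve 3 (λ q₀ q₁ q₂ →
        q₁ :* q₁ :- q₀ :* q₂ := q₁ :* q₁ :- q₂ :* (q₀ :* κ 1 :+ q₁ :* (:- (κ 2 :* κ 0)) :+ q₂ :* κ 0)) refl q₀ q₁ q₂
    }

  conicFamily : ∀ t → InternalFamily (1F , t , t * t)
  conicFamily t = record
    { point = λ a → a * a - δ , a + t * (a * a - δ) , 1F + 2F * t * a + t * t * (a * a - δ)
    ; u = λ (q₀ , q₁ , _) → q₁ - t * q₀
    ; x = λ (q₀ , _ , _) → q₀
    ; u-scale = λ k (q₀ , q₁ , _) →
        solve 4 (λ k q₀ q₁ t → k :* q₁ :- t :* (k :* q₀) := k :* (q₁ :- t :* q₀)) refl k q₀ q₁ t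
    ; u-point = λ a → solve 3 (λ a t δ → a :+ t :* (a :* a :- δ) :- t :* (a :* a :- δ) := a) refl a t δ
    ; polar-point-p = λ a → solve 3 (λ a t δ → let c = a :* a :- δ in
        c :* (t :* t) :+ (a :+ t :* c) :* (:- (κ 2 :* t)) :+ (κ 1 :+ κ 2 :* t :* a :+ t :* t :* c) :* κ 1 := κ 1) refl a t δ
    ; conicForm-point = λ a → solve 3 (λ a t δ → let c = a :* a :- δ in
        (a :+ t :* c) :* (a :+ t :* c) :- c :* (κ 1 :+ κ 2 :* t :* a :+ t :* t :* c) := δ) refl a t δ
    ; polar-point = λ (q₀ , q₁ , q₂) a → solve 6 (λ q₀ q₁ q₂ a t δ → let c = a :* a :- δ in
        q₀ :* (κ 1 :+ κ 2 :* t :* a :+ t :* t :* c) :+ q₁ :* (:- (κ 2 :* (a :+ t :* c))) :+ q₂ :* c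
          := q₀ :- κ 2 :* (q₁ :- t :* q₀) :* a :+ c :* (q₀ :* (t :* t) :+ q₁ :* (:- (κ 2 :* t)) :+ q₂ :* κ 1))
        refl q₀ q₁ q₂ a t δ
    ; conicForm-decomposition = λ (q₀ , q₁ , q₂) → solve 4 (λ q₀ q₁ q₂ t →
        q₁ :* q₁ :- q₀ :* q₂
          := (q₁ :- t :* q₀) :* (q₁ :- t :* q₀) :- q₀ :* (q₀ :* (t :* t) :+ q₁ :* (:- (κ 2 :* t)) :+ q₂ :* κ 1))
        refl q₀ q₁ q₂ t
    }

lemma2p18 : (K : FiniteField) → FiniteField.order K % 4 ≡ 1 →
    let open PG2 K in
    (P : Point) → OnO P →
    ∃[ M ] (IsPointSet M × All Internal M × Odd (length M) ×
      (∀ (Q : Point) → External Q → OnPerp P Q → OddCount (JoinPassant Q) M))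
lemma2p18 K q≡1 (_ , nz) (inj₁ (t , k , k≢0 , refl)) = Family.conclusion (conicFamily t) nz k≢0
  where open Geometry K q≡1
lemma2p18 K q≡1 (_ , nz) (inj₂ (k , k≢0 , refl)) = Family.conclusion vertexFamily nz k≢0
  where open Geometry K q≡1
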